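{- Let $G=(V,E)$ be a complete graph whose edges are labeled $+$ or $-$. Let $\mathcal{C}$ be a clustering of $V$ in which some cluster $C$ contains vertices $u,v$ such that $\{u,v\}$ is a $-$ edge and there is no vertex $w\in C$ for which $\{u,v,w\}$ is a $(+,+,-)$ triangle. Then $\mathcal{C}$ is not an optimal clustering, i.e., there is a clustering of $V$ making strictly fewer mistakes than $\mathcal{C}$.
   Context: A clustering is a partition of $V$. A clustering makes a mistake on a $+$ edge whose endpoints lie in different clusters and on a $-$ edge whose endpoints lie in the same cluster; an optimal clustering minimizes the number of mistakes. A $(+,+,-)$ triangle is a set of three vertices such that two of its three edges are labeled $+$ and one is labeled $-$. -}

module Defs where

open import Data.Nat using (ℕ; zero; suc; _+_; _<_)
open import Data.Bool using (Bool; true; false; not)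
open import Data.Fin using (Fin; toℕ; _≟_)
open import Data.List using (List; map; allFin)
open import Data.Nat.ListAction using (sum)
open import Relation.Nullary using (¬_; yes; no)
open import Relation.Binary.PropositionalEquality using (_≡_)
open import Data.Product using (_×_)

-- A complete graph on vertex set V = Fin n with edges labelled + (true) or - (false).
-- The values lab u u (loops) are irrelevant.
record SignedComplete (n : ℕ) : Set where
  field
    lab : Fin n → Fin n → Bool
    sym : ∀ u v → lab u v ≡ lab v u
open SignedComplete public

-- A clustering (partition of V) is represented by a cluster-assignment map:
-- u and v lie in the same cluster iff cl u ≡ cl v. Every partition of Fin n
-- has at most n blocks, so Fin n suffices as the set of cluster names.
Clustering : ℕ → Set
Clustering n = Fin n → Fin n

sameCluster : ∀ {n} → Clustering n → Fin n → Fin n → Bool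
sameCluster cl u v with cl u ≟ cl v
... | yes _ = true
... | no  _ = false

-- mistake on the edge {u,v}: + edge split, or - edge inside a cluster
mistake : Bool → Bool → ℕ
mistake true  true  = 0
mistake true  false = 1
mistake false true  = 1
mistake false false = 0

mistakes : ∀ {n} → SignedComplete n → Clustering n → ℕ
mistakes {n} G cl =
  sum (map (λ u → sum (map (λ v → pairCost u v) (allFin n))) (allFin n))
  where
  pairCost : Fin n → Fin n → ℕ
  pairCost u v with Data.Nat._<?_ (toℕ u) (toℕ v)
  ... | yes _ = mistake (lab G u v) (sameCluster cl u v)
  ... | no  _ = 0

PPMTriangle : ∀ {n} → SignedComplete n → Fin n → Fin n → Fin n → Set
PPMTriangle G u v w =
  ¬ (u ≡ v) × ¬ (v ≡ w) × ¬ (u ≡ w) ×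
  (negCount (lab G u v) (lab G v w) (lab G u w) ≡ 1)
  where
  b2n : Bool → ℕ
  b2n true = 0
  b2n false = 1
  negCount : Bool → Bool → Bool → ℕ
  negCount a b c = b2n a + b2n b + b2n c

-- Let x be a cluster name not in use (one exists since u and v share a name), and compare
-- the clusterings obtained by moving u, resp. v, alone into cluster x. Each move changes only
-- the edges at the moved vertex, so compare the cost of those edges. For w in the old cluster
-- other than u and v, moving u makes uw cost [uw is +] and moving v makes vw cost [vw is +],
-- against [uw is −] and [vw is −] before; since uvw is not a (+,+,−) triangle, uw and vw are
-- not both +, so [uw is +] + [vw is +] ≤ [uw is −] + [vw is −]. Edges to other clusters keep
-- their cost, and the − edge uv, a mistake before, is correct after either move. Summing, the
-- two moves together strictly lower the cost, so one of them alone does.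
module Submission where

open import Defs hiding (sym)
open import Data.Nat using (ℕ; zero; suc; _+_; _≤_; _<_; _<?_; z≤n; s≤s)
open import Data.Nat.Properties
  using (+-0-commutativeMonoid; +-mono-≤; +-mono-<-≤; +-monoʳ-<; +-cancelˡ-<; ≮⇒≥; +-identityʳ; ≤-refl;
         <-irrefl; <-cmp; n<1+n; module ≤-Reasoning)
open import Data.Nat.Solver using (module +-*-Solver)
open import Data.Nat.ListAction using (sum)
open import Data.Fin using (Fin; toℕ; _≟_; punchIn; punchOut)
open import Data.Fin.Properties using (toℕ-injective; punchInᵢ≢i; punchIn-punchOut; any?; all?; ¬∀⟶∃¬; <⇒notInjective)
open import Data.Bool using (true; false)
open import Data.List using (map; allFin; tabulate)
open import Data.List.Properties using (map-tabulate)
open import Data.Product using (Σ; ∃; _×_; _,_; proj₁; proj₂)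
open import Data.Sum as Sum using (_⊎_; inj₁; inj₂)
open import Function using (_∘_)
open import Function.Definitions using (Injective)
open import Relation.Nullary using (¬_; yes; no; contradiction)
open import Relation.Binary using (tri<; tri≈; tri>)
open import Relation.Binary.PropositionalEquality
  using (_≡_; _≢_; refl; sym; trans; cong; cong₂; subst₂; module ≡-Reasoning)
open import Algebra.Properties.CommutativeMonoid.Sum +-0-commutativeMonoid
  using (sum-syntax; sum-cong-≗; sum-remove; ∑-distrib-+)
  renaming (sum to ∑)

sum-tabulate : ∀ {n} (f : Fin n → ℕ) → sum (tabulate f) ≡ ∑ f
sum-tabulate {zero}  f = refl
sum-tabulate {suc n} f = cong (f Fin.zero +_) (sum-tabulate (f ∘ Fin.suc))

sum-map-allFin : ∀ {n} (f : Fin n → ℕ) → sum (map f (allFin n)) ≡ ∑ f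
sum-map-allFin f = trans (cong sum (map-tabulate (λ i → i) f)) (sum-tabulate f)

∑-mono-≤ : ∀ {n} {f g : Fin n → ℕ} → (∀ i → f i ≤ g i) → ∑ f ≤ ∑ g
∑-mono-≤ {zero}  f≤g = z≤n
∑-mono-≤ {suc n} f≤g = +-mono-≤ (f≤g Fin.zero) (∑-mono-≤ (f≤g ∘ Fin.suc))

∑-mono-< : ∀ {n} {f g : Fin (suc n) → ℕ} (i : Fin (suc n)) →
           (∀ j → f j ≤ g j) → f i < g i → ∑ f < ∑ g
∑-mono-< {f = f} {g} i f≤g fi<gi = begin-strict
  ∑ f                          ≡⟨ sum-remove f ⟩
  f i + ∑ (f ∘ punchIn i)      <⟨ +-mono-<-≤ fi<gi (∑-mono-≤ (f≤g ∘ punchIn i)) ⟩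
  g i + ∑ (g ∘ punchIn i)      ≡⟨ sum-remove g ⟨
  ∑ g                          ∎
  where open ≤-Reasoning

+-<-+⇒<⊎< : ∀ {a b c d} → a + b < c + d → a < c ⊎ b < d
+-<-+⇒<⊎< {a} {b} {c} {d} a+b<c+d with a <? c
... | yes a<c = inj₁ a<c
... | no  a≮c = inj₂ (+-cancelˡ-< c b d (begin-strict
  c + b   ≤⟨ +-mono-≤ (≮⇒≥ a≮c) ≤-refl ⟩
  a + b   <⟨ a+b<c+d ⟩
  c + d   ∎))
  where open ≤-Reasoning

-- The last sum counts f z z twice, hence the extra f z z on the left.
∑∑-remove : ∀ {n} (z : Fin (suc n)) (f : Fin (suc n) → Fin (suc n) → ℕ) →
            ∑[ a < suc n ] ∑[ b < suc n ] f a b + f z z ≡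
            ∑[ a < n ] ∑[ b < n ] f (punchIn z a) (punchIn z b) + ∑[ w < suc n ] (f z w + f w z)
∑∑-remove {n} z f = begin
  ∑[ a < suc n ] row a + f z z
    ≡⟨ cong (_+ f z z) (sum-remove row) ⟩
  row z + ∑[ a < n ] row (punchIn z a) + f z z
    ≡⟨ cong₂ (λ r s → r + s + f z z) (sum-remove (f z)) (sum-cong-≗ (λ a → sum-remove (f (punchIn z a)))) ⟩
  f z z + ∑ zRow + ∑[ a < n ] (f (punchIn z a) z + rest a) + f z z
    ≡⟨ cong (λ s → f z z + ∑ zRow + s + f z z) (∑-distrib-+ (λ a → f (punchIn z a) z) rest) ⟩
  f z z + ∑ zRow + (∑ zCol + ∑ rest) + f z z
    ≡⟨ solve 4 (λ d r c s → d :+ r :+ (c :+ s) :+ d := s :+ ((d :+ r) :+ (d :+ c))) refl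
         (f z z) (∑ zRow) (∑ zCol) (∑ rest) ⟩
  ∑ rest + ((f z z + ∑ zRow) + (f z z + ∑ zCol))
    ≡⟨ cong (∑ rest +_) (cong₂ _+_ (sum-remove (f z)) (sum-remove (λ w → f w z))) ⟨
  ∑ rest + (∑ (f z) + ∑ (λ w → f w z))
    ≡⟨ cong (∑ rest +_) (∑-distrib-+ (f z) (λ w → f w z)) ⟨
  ∑ rest + ∑[ w < suc n ] (f z w + f w z)
    ∎
  where
  open ≡-Reasoning
  open +-*-Solver
  row : Fin (suc n) → ℕ
  row a = ∑ (f a)
  zRow zCol rest : Fin n → ℕ
  zRow b = f z (punchIn z b)
  zCol a = f (punchIn z a) z
  rest a = ∑[ b < n ] f (punchIn z a) (punchIn z b)

sameCluster-≡ : ∀ {n} (cl : Clustering n) {a b} → cl a ≡ cl b → sameCluster cl a b ≡ true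
sameCluster-≡ cl {a} {b} cla≡clb with cl a ≟ cl b
... | yes _       = refl
... | no  cla≢clb = contradiction cla≡clb cla≢clb

sameCluster-≢ : ∀ {n} (cl : Clustering n) {a b} → cl a ≢ cl b → sameCluster cl a b ≡ false
sameCluster-≢ cl {a} {b} cla≢clb with cl a ≟ cl b
... | yes cla≡clb = contradiction cla≡clb cla≢clb
... | no  _       = refl

sameCluster-sym : ∀ {n} (cl : Clustering n) a b → sameCluster cl a b ≡ sameCluster cl b a
sameCluster-sym cl a b with cl a ≟ cl b
... | yes cla≡clb = sym (sameCluster-≡ cl (sym cla≡clb))
... | no  cla≢clb = sym (sameCluster-≢ cl (cla≢clb ∘ sym))

sameCluster-cong : ∀ {n} (cl cl′ : Clustering n) {a b} → cl a ≡ cl′ a → cl b ≡ cl′ b →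
                   sameCluster cl a b ≡ sameCluster cl′ a b
sameCluster-cong cl cl′ {a} {b} ea eb with cl a ≟ cl b
... | yes cla≡clb = sym (sameCluster-≡ cl′ (trans (sym ea) (trans cla≡clb eb)))
... | no  cla≢clb = sym (sameCluster-≢ cl′ λ e → cla≢clb (trans ea (trans e (sym eb))))

edgeMistake : ∀ {n} → SignedComplete n → Clustering n → Fin n → Fin n → ℕ
edgeMistake G cl a b = mistake (lab G a b) (sameCluster cl a b)

edgeMistake-sym : ∀ {n} (G : SignedComplete n) cl a b → edgeMistake G cl a b ≡ edgeMistake G cl b a
edgeMistake-sym G cl a b = cong₂ mistake (SignedComplete.sym G a b) (sameCluster-sym cl a b)

-- The summand of mistakes is local to Defs; the meta below is solved by unification with it.
mutual
  pairCost : ∀ {n} → SignedComplete n → Clustering n → Fin n → Fin n → ℕ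
  pairCost G cl = _

  mistakes-unfold : ∀ {n} (G : SignedComplete n) cl →
                    mistakes G cl ≡ sum (map (λ a → sum (map (pairCost G cl a) (allFin n))) (allFin n))
  mistakes-unfold G cl = refl

mistakes-∑∑ : ∀ {n} (G : SignedComplete n) cl → mistakes G cl ≡ ∑[ a < n ] ∑[ b < n ] pairCost G cl a b
mistakes-∑∑ {n} G cl = trans (mistakes-unfold G cl)
  (trans (sum-map-allFin (λ a → sum (map (pairCost G cl a) (allFin n))))
         (sum-cong-≗ (λ a → sum-map-allFin (pairCost G cl a))))

pairCost-< : ∀ {n} (G : SignedComplete n) cl {a b} → toℕ a < toℕ b → pairCost G cl a b ≡ edgeMistake G cl a b
pairCost-< G cl {a} {b} a<b with toℕ a <? toℕ b
... | yes _   = refl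
... | no  a≮b = contradiction a<b a≮b

pairCost-≮ : ∀ {n} (G : SignedComplete n) cl {a b} → ¬ toℕ a < toℕ b → pairCost G cl a b ≡ 0
pairCost-≮ G cl {a} {b} a≮b with toℕ a <? toℕ b
... | yes a<b = contradiction a<b a≮b
... | no  _   = refl

pairCost-cong : ∀ {n} (G : SignedComplete n) (cl cl′ : Clustering n) {a b} → cl a ≡ cl′ a → cl b ≡ cl′ b →
                pairCost G cl a b ≡ pairCost G cl′ a b
pairCost-cong G cl cl′ {a} {b} ea eb with toℕ a <? toℕ b
... | yes _ = cong (mistake (lab G a b)) (sameCluster-cong cl cl′ ea eb)
... | no  _ = refl

incidentCost : ∀ {n} → SignedComplete n → Clustering n → Fin n → Fin n → ℕ
incidentCost G cl z w = pairCost G cl z w + pairCost G cl w z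

incidentCost-self : ∀ {n} (G : SignedComplete n) cl z → incidentCost G cl z z ≡ 0
incidentCost-self G cl z rewrite pairCost-≮ G cl {z} {z} (<-irrefl refl) = refl

incidentCost-≢ : ∀ {n} (G : SignedComplete n) cl {z w} → z ≢ w → incidentCost G cl z w ≡ edgeMistake G cl z w
incidentCost-≢ G cl {z} {w} z≢w with <-cmp (toℕ z) (toℕ w)
... | tri< z<w _ w≮z
  rewrite pairCost-< G cl z<w | pairCost-≮ G cl w≮z = +-identityʳ _
... | tri≈ _ z≡w _ = contradiction (toℕ-injective z≡w) z≢w
... | tri> z≮w _ w<z
  rewrite pairCost-≮ G cl z≮w | pairCost-< G cl w<z = edgeMistake-sym G cl w z

incidentCost-<⇒mistakes-< : ∀ {n} (G : SignedComplete n) (cl cl′ : Clustering n) z →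
  (∀ w → w ≢ z → cl′ w ≡ cl w) →
  ∑[ w < n ] incidentCost G cl′ z w < ∑[ w < n ] incidentCost G cl z w →
  mistakes G cl′ < mistakes G cl
incidentCost-<⇒mistakes-< {suc n} G cl cl′ z agree incident< = begin-strict
  mistakes G cl′                                     ≡⟨ mistakes-∑∑ G cl′ ⟩
  ∑[ a < suc n ] ∑[ b < suc n ] pairCost G cl′ a b    ≡⟨ split cl′ ⟩
  rest cl′ + ∑ (incidentCost G cl′ z)                 ≡⟨ cong (_+ ∑ (incidentCost G cl′ z)) rest-agrees ⟩
  rest cl + ∑ (incidentCost G cl′ z)                  <⟨ +-monoʳ-< (rest cl) incident< ⟩
  rest cl + ∑ (incidentCost G cl z)                   ≡⟨ split cl ⟨
  ∑[ a < suc n ] ∑[ b < suc n ] pairCost G cl a b     ≡⟨ mistakes-∑∑ G cl ⟨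
  mistakes G cl                                      ∎
  where
  open ≤-Reasoning
  rest : Clustering (suc n) → ℕ
  rest c = ∑[ a < n ] ∑[ b < n ] pairCost G c (punchIn z a) (punchIn z b)
  split : ∀ c → ∑[ a < suc n ] ∑[ b < suc n ] pairCost G c a b ≡ rest c + ∑ (incidentCost G c z)
  split c = begin-equality
    ∑[ a < suc n ] ∑[ b < suc n ] pairCost G c a b            ≡⟨ +-identityʳ _ ⟨
    ∑[ a < suc n ] ∑[ b < suc n ] pairCost G c a b + 0        ≡⟨ cong (_ +_) (pairCost-≮ G c {z} {z} (<-irrefl refl)) ⟨
    ∑[ a < suc n ] ∑[ b < suc n ] pairCost G c a b + pairCost G c z z  ≡⟨ ∑∑-remove z (pairCost G c) ⟩
    rest c + ∑ (incidentCost G c z)                           ∎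
  rest-agrees : rest cl′ ≡ rest cl
  rest-agrees = sum-cong-≗ λ a → sum-cong-≗ λ b →
    pairCost-cong G cl′ cl (agree _ (punchInᵢ≢i z a)) (agree _ (punchInᵢ≢i z b))

isolate : ∀ {n} → Clustering n → Fin n → Fin n → Clustering n
isolate cl z x w with w ≟ z
... | yes _ = x
... | no  _ = cl w

isolate-self : ∀ {n} (cl : Clustering n) z x → isolate cl z x z ≡ x
isolate-self cl z x with z ≟ z
... | yes _   = refl
... | no  z≢z = contradiction refl z≢z

isolate-≢ : ∀ {n} (cl : Clustering n) {z} x {w} → w ≢ z → isolate cl z x w ≡ cl w
isolate-≢ cl {z} x {w} w≢z with w ≟ z
... | yes w≡z = contradiction w≡z w≢z
... | no  _   = refl

incidentCost-isolate : ∀ {n} (G : SignedComplete n) cl {x} → (∀ w → cl w ≢ x) →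
                       ∀ {z w} → z ≢ w → incidentCost G (isolate cl z x) z w ≡ mistake (lab G z w) false
incidentCost-isolate G cl {x} x-unused {z} {w} z≢w = begin
  incidentCost G (isolate cl z x) z w                     ≡⟨ incidentCost-≢ G (isolate cl z x) z≢w ⟩
  mistake (lab G z w) (sameCluster (isolate cl z x) z w)  ≡⟨ cong (mistake (lab G z w)) (sameCluster-≢ _ separated) ⟩
  mistake (lab G z w) false                               ∎
  where
  open ≡-Reasoning
  separated : isolate cl z x z ≢ isolate cl z x w
  separated e = x-unused w (trans (sym (isolate-≢ cl x (z≢w ∘ sym))) (trans (sym e) (isolate-self cl z x)))

collision⇒missedValue : ∀ {n} (f : Fin n → Fin n) {a b} → a ≢ b → f a ≡ f b → ∃ λ y → ∀ x → f x ≢ y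
collision⇒missedValue {n} f a≢b fa≡fb with all? (λ y → any? (λ x → f x ≟ y))
... | no ¬surjective =
  let (y , ¬hit) = ¬∀⟶∃¬ n _ (λ y → any? (λ x → f x ≟ y)) ¬surjective in y , λ x fx≡y → ¬hit (x , fx≡y)
collision⇒missedValue {suc m} f {a} {b} a≢b fa≡fb | yes surjective =
  contradiction (λ {y} {y′} → section-injective {y} {y′}) (<⇒notInjective (n<1+n m))
  where
  preimage≠a : ∀ y → ∃ λ x → a ≢ x × f x ≡ y
  preimage≠a y with surjective y
  ... | x , fx≡y with x ≟ a
  ...   | yes refl = b , a≢b , trans (sym fa≡fb) fx≡y
  ...   | no  x≢a  = x , x≢a ∘ sym , fx≡y
  section : Fin (suc m) → Fin m
  section y = punchOut (proj₁ (proj₂ (preimage≠a y)))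
  section-inverse : ∀ y → f (punchIn a (section y)) ≡ y
  section-inverse y = trans (cong f (punchIn-punchOut _)) (proj₂ (proj₂ (preimage≠a y)))
  section-injective : Injective _≡_ _≡_ section
  section-injective {y} {y′} e =
    trans (sym (section-inverse y)) (trans (cong (f ∘ punchIn a) e) (section-inverse y′))

separating-≤-joining : ∀ {s t} → ¬ (s ≡ true × t ≡ true) →
                       mistake s false + mistake t false ≤ mistake s true + mistake t true
separating-≤-joining {true}  {true}  ¬both = contradiction (refl , refl) ¬both
separating-≤-joining {true}  {false} ¬both = s≤s z≤n
separating-≤-joining {false} {true}  ¬both = s≤s z≤n
separating-≤-joining {false} {false} ¬both = z≤n

ppmTriangle : ∀ {n} (G : SignedComplete n) {u v w} → u ≢ v → v ≢ w → u ≢ w →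
              lab G u v ≡ false → lab G v w ≡ true → lab G u w ≡ true → PPMTriangle G u v w
ppmTriangle G u≢v v≢w u≢w uv⁻ vw⁺ uw⁺ rewrite uv⁻ | vw⁺ | uw⁺ = u≢v , v≢w , u≢w , refl

isolating-one-endpoint-helps :
  ∀ {n} (G : SignedComplete n) (cl : Clustering n) {u v x} →
  u ≢ v → cl u ≡ cl v → lab G u v ≡ false →
  (∀ w → cl w ≡ cl u → ¬ PPMTriangle G u v w) → (∀ w → cl w ≢ x) →
  mistakes G (isolate cl u x) < mistakes G cl ⊎ mistakes G (isolate cl v x) < mistakes G cl
isolating-one-endpoint-helps {suc n} G cl {u} {v} {x} u≢v clu≡clv uv⁻ noTriangle x-unused
  = Sum.map (incidentCost-<⇒mistakes-< G cl (isolate cl u x) u (λ _ → isolate-≢ cl x))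
            (incidentCost-<⇒mistakes-< G cl (isolate cl v x) v (λ _ → isolate-≢ cl x))
            (+-<-+⇒<⊎< incident<)
  where
  before after : Fin (suc n) → ℕ
  before w = incidentCost G cl u w + incidentCost G cl v w
  after  w = incidentCost G (isolate cl u x) u w + incidentCost G (isolate cl v x) v w

  vu⁻ : lab G v u ≡ false
  vu⁻ = trans (SignedComplete.sym G v u) uv⁻

  after-u : after u ≡ 0
  after-u rewrite incidentCost-self G (isolate cl u x) u
                | incidentCost-isolate G cl x-unused (u≢v ∘ sym) | vu⁻ = refl

  after-v : after v ≡ 0
  after-v rewrite incidentCost-isolate G cl x-unused u≢v | uv⁻
                | incidentCost-self G (isolate cl v x) v = refl

  before-v : before v ≡ 1
  before-v rewrite incidentCost-≢ G cl u≢v | incidentCost-self G cl v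
                 | sameCluster-≡ cl clu≡clv | uv⁻ = refl

  after≤before : ∀ w → after w ≤ before w
  after≤before w with w ≟ u | w ≟ v
  ... | yes refl | _        rewrite after-u = z≤n
  ... | no _     | yes refl rewrite after-v = z≤n
  ... | no w≢u   | no w≢v
    rewrite incidentCost-isolate G cl x-unused (w≢u ∘ sym) | incidentCost-isolate G cl x-unused (w≢v ∘ sym)
          | incidentCost-≢ G cl (w≢u ∘ sym) | incidentCost-≢ G cl (w≢v ∘ sym)
    with cl w ≟ cl u
  ... | yes clw≡clu
    rewrite sameCluster-≡ cl (sym clw≡clu) | sameCluster-≡ cl (trans (sym clu≡clv) (sym clw≡clu))
    = separating-≤-joining λ (uw⁺ , vw⁺) → noTriangle w clw≡clu (ppmTriangle G u≢v (w≢v ∘ sym) (w≢u ∘ sym) uv⁻ vw⁺ uw⁺)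
  ... | no clw≢clu
    rewrite sameCluster-≢ cl (clw≢clu ∘ sym) | sameCluster-≢ cl (clw≢clu ∘ sym ∘ trans clu≡clv) = ≤-refl

  incident< : ∑ (incidentCost G (isolate cl u x) u) + ∑ (incidentCost G (isolate cl v x) v)
            < ∑ (incidentCost G cl u) + ∑ (incidentCost G cl v)
  incident< = begin-strict
    ∑ (incidentCost G (isolate cl u x) u) + ∑ (incidentCost G (isolate cl v x) v)
      ≡⟨ ∑-distrib-+ (incidentCost G (isolate cl u x) u) (incidentCost G (isolate cl v x) v) ⟨
    ∑ after
      <⟨ ∑-mono-< v after≤before (subst₂ _<_ (sym after-v) (sym before-v) (s≤s z≤n)) ⟩
    ∑ before
      ≡⟨ ∑-distrib-+ (incidentCost G cl u) (incidentCost G cl v) ⟩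
    ∑ (incidentCost G cl u) + ∑ (incidentCost G cl v)
      ∎
    where open ≤-Reasoning

lemma2 : ∀ {n} (G : SignedComplete n) (cl : Clustering n) (u v : Fin n) →
         ¬ (u ≡ v) → cl u ≡ cl v → lab G u v ≡ false →
         (∀ w → cl w ≡ cl u → ¬ PPMTriangle G u v w) →
         Σ (Clustering n) (λ cl′ → mistakes G cl′ < mistakes G cl)
lemma2 G cl u v u≢v clu≡clv uv⁻ noTriangle
  with x , x-unused ← collision⇒missedValue cl u≢v clu≡clv
  with isolating-one-endpoint-helps G cl u≢v clu≡clv uv⁻ noTriangle x-unused
... | inj₁ u-helps = isolate cl u x , u-helps
... | inj₂ v-helps = isolate cl v x , v-helps
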